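{- If $G$ and $H$ are 3-symmetric graphs, each with more than one vertex, then $\operatorname{inflate}(G,H)$ is not 3-symmetric.
   Context: All graphs are finite simple graphs. For a graph $S$ on $3$ vertices and a graph $G$ on $n$ vertices, $t(S,G)$ is the number of $3$-element vertex subsets of $G$ inducing a subgraph isomorphic to $S$, divided by $\binom{n}{3}$ ($0$ if $n<3$). A graph $G$ is 3-symmetric if it has fewer than 3 vertices, or it has at least 3 vertices and $t(K_3,G)=t(\overline{K_3},G)=1/8$ and $t(P_3,G)=t(\overline{P_3},G)=3/8$, where $K_3$ is the triangle, $\overline{K_3}$ the edgeless graph on 3 vertices, $P_3$ the path on 3 vertices, and $\overline{P_3}$ the graph on 3 vertices with exactly one edge. The inflation $\operatorname{inflate}(G,H)$ is the graph with vertex set $V(G)\times V(H)$ in which $(u,a)$ and $(v,b)$ are adjacent iff either $u=v$ and $ab\in E(H)$, or $uv\in E(G)$. -}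

module Defs where

open import Data.Nat using (ℕ; zero; suc; _+_; _*_; _<_; _<ᵇ_)
open import Data.Nat.Combinatorics using (_C_)
open import Data.Bool using (Bool; true; false; _∨_; _∧_; if_then_else_)
open import Data.Fin using (Fin; toℕ; remQuot; _≟_)
open import Data.List using (List; []; _∷_; length; filter; concatMap; allFin)
open import Data.Product using (_×_; _,_; proj₁; proj₂)
open import Data.Sum using (_⊎_)
open import Data.Empty using (⊥-elim)
open import Relation.Nullary using (yes; no; ¬_)
open import Relation.Binary.PropositionalEquality using (_≡_; refl; sym; cong; trans)
import Data.Nat as ℕ

record Graph : Set where
  field
    n      : ℕ
    adj    : Fin n → Fin n → Bool
    adj-sym    : ∀ i j → adj i j ≡ adj j i
    adj-irrefl : ∀ i → adj i i ≡ false
open Graph public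

b2n : Bool → ℕ
b2n true = 1
b2n false = 0

edges3 : (G : Graph) → Fin (n G) → Fin (n G) → Fin (n G) → ℕ
edges3 G i j k = b2n (adj G i j) + b2n (adj G i k) + b2n (adj G j k)

triples : (m : ℕ) → List (Fin m × Fin m × Fin m)
triples m =
  concatMap (λ i → concatMap (λ j → concatMap (λ k →
    if (toℕ i <ᵇ toℕ j) ∧ (toℕ j <ᵇ toℕ k) then (i , j , k) ∷ [] else [])
    (allFin m)) (allFin m)) (allFin m)

-- A graph on 3 vertices is determined up to isomorphism by its number of
-- edges: K̄₃ ↔ 0, P̄₃ ↔ 1, P₃ ↔ 2, K₃ ↔ 3.
-- inducedCount G e = number of 3-subsets of V(G) inducing the 3-vertex graph
-- with e edges.
inducedCount : Graph → ℕ → ℕ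
inducedCount G e =
  length (filter (λ t → edges3 G (proj₁ t) (proj₁ (proj₂ t)) (proj₂ (proj₂ t)) ℕ.≟ e)
                 (triples (n G)))

-- 3-symmetric: fewer than 3 vertices, or t(K₃)=t(K̄₃)=1/8 and t(P₃)=t(P̄₃)=3/8,
-- where t(S,G) = inducedCount / C(n,3); the rational equalities are
-- written multiplied out (8 · count = k · C(n,3)).
ThreeSymmetric : Graph → Set
ThreeSymmetric G =
  n G < 3 ⊎
  ( (3 ℕ.≤ n G)
  × (8 * inducedCount G 3 ≡ 1 * (n G C 3))
  × (8 * inducedCount G 0 ≡ 1 * (n G C 3))
  × (8 * inducedCount G 2 ≡ 3 * (n G C 3))
  × (8 * inducedCount G 1 ≡ 3 * (n G C 3)))

eqb : ∀ {m} → Fin m → Fin m → Bool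
eqb u v with u ≟ v
... | yes _ = true
... | no _ = false

pairAdj : (G H : Graph) → Fin (n G) × Fin (n H) → Fin (n G) × Fin (n H) → Bool
pairAdj G H (u , a) (v , b) = (eqb u v ∧ adj H a b) ∨ adj G u v

private
  eqb-refl : ∀ {m} (u : Fin m) → eqb u u ≡ true
  eqb-refl u with u ≟ u
  ... | yes _ = refl
  ... | no ¬p = ⊥-elim (¬p refl)

  eqb-sym : ∀ {m} (u v : Fin m) → eqb u v ≡ eqb v u
  eqb-sym u v with u ≟ v | v ≟ u
  ... | yes _ | yes _ = refl
  ... | no _ | no _ = refl
  ... | yes p | no ¬q = ⊥-elim (¬q (sym p))
  ... | no ¬p | yes q = ⊥-elim (¬p (sym q))

  pairAdj-sym : ∀ G H x y → pairAdj G H x y ≡ pairAdj G H y x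
  pairAdj-sym G H (u , a) (v , b)
    rewrite eqb-sym u v | adj-sym H a b | adj-sym G u v = refl

  pairAdj-irr : ∀ G H x → pairAdj G H x x ≡ false
  pairAdj-irr G H (u , a) rewrite eqb-refl u | adj-irrefl H a | adj-irrefl G u = refl

inflate : Graph → Graph → Graph
inflate G H = record
  { n = n G * n H
  ; adj = λ x y → pairAdj G H (remQuot (n H) x) (remQuot (n H) y)
  ; adj-sym = λ x y → pairAdj-sym G H (remQuot (n H) x) (remQuot (n H) y)
  ; adj-irrefl = λ x → pairAdj-irr G H (remQuot (n H) x)
  }

module Submission where

open import Defs
open import Data.Bool using (Bool; true; false; _∧_; _∨_; if_then_else_)
open import Data.Bool.Properties using (∨-identityʳ; ∧-identityʳ; ∧-zeroʳ; ∧-comm)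
import Data.Bool as Bool
open import Data.Fin using (Fin; zero; suc; toℕ; combine; remQuot; _↑ˡ_; _↑ʳ_; _<?_)
  renaming (_<_ to _<ᶠ_; _≟_ to _≟ᶠ_)
open import Data.Fin.Properties
  using (<-cmp; <-irrefl; <-trans; <⇒≢; combine-monoˡ-<; toℕ-combine; remQuot-combine)
open import Data.List using (List; []; _∷_; _++_; length; filter; concatMap; tabulate)
open import Data.List.Properties using (filter-++; length-++)
open import Data.Nat using (ℕ; zero; suc; _+_; _*_; _<_; _≤_; NonZero; >-nonZero; z≤n; s≤s)
open import Data.Nat.Combinatorics using (_C_; k>n⇒nCk≡0)
open import Data.Nat.Properties
  using ( <-asym; <⇒≤; ≤-trans; m≤m+n; m≤n+m; m<n⇒n≢0; +-cancelˡ-<; +-monoʳ-<; *-mono-≤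
        ; +-identityʳ; +-comm; +-assoc; +-cancelˡ-≡; *-zeroʳ; *-comm; *-assoc; *-cancelˡ-≡; m*n≡0⇒m≡0∨n≡0
        ; +-*-semiring)
open import Algebra.Properties.Semiring.Sum +-*-semiring
  using (sum-syntax; sum-cong-≗; sum-replicate-zero; ∑-distrib-+; ∑-comm; *-distribˡ-sum)
import Data.Nat as ℕ
open import Data.Nat.Tactic.RingSolver using (solve-∀)
open import Data.Product using (_×_; _,_; proj₁; proj₂)
open import Data.Sum using (_⊎_; inj₁; inj₂; reduce)
open import Function using (id; _∘_; _⇔_; mk⇔)
open import Level using (0ℓ)
open import Relation.Unary using (Pred)
import Relation.Unary as U
open import Relation.Binary using (tri<; tri≈; tri>)
open import Relation.Nullary using (¬_; Dec; yes; no; does; contradiction; _⊎-dec_; _×-dec_)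
open import Relation.Nullary.Decidable using (dec-true; dec-false; does-⇔)
open import Relation.Binary.PropositionalEquality

-- Count the 3-subsets of the inflation G[H] (|G| = N, |H| = M) by how they meet the copies
-- of H: inside one copy, across three copies, or two vertices in one copy and one in another.
-- The number T_e of 3-subsets spanning e edges then satisfies
--   T_e(G[H]) = M³ T_e(G) + N T_e(H) + 2M · #{u < w in G, a < b in H : [ab ∈ E(H)] + 2[uw ∈ E(G)] = e},
-- and writing e = α + 2β in binary the last count is p_β(G) p_α(H), where p₁ and p₀ count edges
-- and non-edges. If G, H and G[H] were all 3-symmetric, the densities 1/8, 3/8, 3/8, 1/8 of
-- e = 0, 1, 2, 3 would force p₀(G)p₀(H) = p₁(G)p₁(H) = q and p₀(G)p₁(H) = p₁(G)p₀(H) = 3q.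
-- Multiplying gives 9q² = q², so q = 0 and all four products vanish, although G and H both
-- have a pair of vertices.

b2n-∧ : ∀ x y → b2n (x ∧ y) ≡ b2n x * b2n y
b2n-∧ true  y = sym (+-identityʳ (b2n y))
b2n-∧ false y = refl

∧-exchange : ∀ x y z → x ∧ (y ∧ z) ≡ y ∧ (x ∧ z)
∧-exchange false y     z = sym (∧-zeroʳ y)
∧-exchange true  false z = refl
∧-exchange true  true  z = refl

+-rotate : ∀ x y → x + x + y ≡ y + x + x
+-rotate x y = trans (+-comm (x + x) y) (sym (+-assoc y x x))

∑-cong : ∀ {k} {f g : Fin k → ℕ} → (∀ i → f i ≡ g i) → ∑[ i < k ] f i ≡ ∑[ i < k ] g i
∑-cong = sum-cong-≗

∑-*ˡ : ∀ {k} c (f : Fin k → ℕ) → ∑[ i < k ] (c * f i) ≡ c * ∑[ i < k ] f i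
∑-*ˡ c f = sym (*-distribˡ-sum c f)

∑-const : ∀ k c → ∑[ i < k ] c ≡ k * c
∑-const zero    c = refl
∑-const (suc k) c = cong (c +_) (∑-const k c)

∑-↑ : ∀ k l (f : Fin (k + l) → ℕ) →
  ∑[ x < k + l ] f x ≡ ∑[ i < k ] f (i ↑ˡ l) + ∑[ j < l ] f (k ↑ʳ j)
∑-↑ zero    l f = refl
∑-↑ (suc k) l f = trans (cong (f zero +_) (∑-↑ k l (f ∘ suc))) (sym (+-assoc (f zero) _ _))

∑-combine : ∀ k l (f : Fin (k * l) → ℕ) →
  ∑[ x < k * l ] f x ≡ ∑[ i < k ] ∑[ j < l ] f (combine i j)
∑-combine zero    l f = refl
∑-combine (suc k) l f =
  trans (∑-↑ l (k * l) f) (cong (∑[ j < l ] f (j ↑ˡ (k * l)) +_) (∑-combine k l (f ∘ (l ↑ʳ_))))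

∑-δ : ∀ k (u : Fin k) (f : Fin k → ℕ) → ∑[ v < k ] (b2n (does (u ≟ᶠ v)) * f v) ≡ f u
∑-δ (suc k) zero    f = begin
  f zero + 0 + ∑[ v < k ] (0 * f (suc v))  ≡⟨ cong (f zero + 0 +_) (sum-replicate-zero k) ⟩
  f zero + 0 + 0                         ≡⟨ +-identityʳ _ ⟩
  f zero + 0                             ≡⟨ +-identityʳ _ ⟩
  f zero                                 ∎
  where open ≡-Reasoning
∑-δ (suc k) (suc u) f = ∑-δ k u (f ∘ suc)

∑-δ-∧ˡ : ∀ k (u : Fin k) (x : Fin k → Bool) (f : Fin k → ℕ) →
  ∑[ v < k ] (b2n (does (u ≟ᶠ v) ∧ x v) * f v) ≡ b2n (x u) * f u
∑-δ-∧ˡ k u x f = trans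
  (∑-cong λ v → trans (cong (_* f v) (b2n-∧ (does (u ≟ᶠ v)) (x v)))
                      (*-assoc (b2n (does (u ≟ᶠ v))) (b2n (x v)) (f v)))
  (∑-δ k u λ v → b2n (x v) * f v)

∑-δ-∧ʳ : ∀ k (u : Fin k) (x : Fin k → Bool) (f : Fin k → ℕ) →
  ∑[ v < k ] (b2n (x v ∧ does (u ≟ᶠ v)) * f v) ≡ b2n (x u) * f u
∑-δ-∧ʳ k u x f =
  trans (∑-cong λ v → cong (λ y → b2n y * f v) (∧-comm (x v) (does (u ≟ᶠ v)))) (∑-δ-∧ˡ k u x f)

≤-∑ : ∀ {k} (f : Fin k → ℕ) i → f i ≤ ∑[ j < k ] f j
≤-∑ f zero    = m≤m+n _ _
≤-∑ f (suc i) = ≤-trans (≤-∑ (f ∘ suc) i) (m≤n+m _ _)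

∑² : ∀ k → (Fin k → Fin k → ℕ) → ℕ
∑² k f = ∑[ i < k ] ∑[ j < k ] f i j

∑³ : ∀ k → (Fin k → Fin k → Fin k → ℕ) → ℕ
∑³ k f = ∑[ i < k ] ∑[ j < k ] ∑[ l < k ] f i j l

∑³-cong : ∀ {k} {f g : Fin k → Fin k → Fin k → ℕ} →
  (∀ i j l → f i j l ≡ g i j l) → ∑³ k f ≡ ∑³ k g
∑³-cong f≗g = ∑-cong λ i → ∑-cong λ j → ∑-cong (f≗g i j)

∑²-*ˡ : ∀ k c (f : Fin k → Fin k → ℕ) → ∑² k (λ i j → c * f i j) ≡ c * ∑² k f
∑²-*ˡ k c f = trans (∑-cong λ i → ∑-*ˡ c (f i)) (∑-*ˡ c λ i → ∑[ j < k ] f i j)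

∑³-*ˡ : ∀ k c (f : Fin k → Fin k → Fin k → ℕ) → ∑³ k (λ i j l → c * f i j l) ≡ c * ∑³ k f
∑³-*ˡ k c f = trans (∑-cong λ i → ∑²-*ˡ k c (f i)) (∑-*ˡ c λ i → ∑² k (f i))

∑²-+ : ∀ k (f g : Fin k → Fin k → ℕ) → ∑² k (λ i j → f i j + g i j) ≡ ∑² k f + ∑² k g
∑²-+ k f g =
  trans (∑-cong λ i → ∑-distrib-+ (f i) (g i)) (∑-distrib-+ (λ i → ∑[ j < k ] f i j) (λ i → ∑[ j < k ] g i j))

∑³-+ : ∀ k (f g : Fin k → Fin k → Fin k → ℕ) →
  ∑³ k (λ i j l → f i j l + g i j l) ≡ ∑³ k f + ∑³ k g
∑³-+ k f g = trans (∑-cong λ i → ∑²-+ k (f i) (g i)) (∑-distrib-+ (λ i → ∑² k (f i)) (λ i → ∑² k (g i)))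

∑²-∧ : ∀ k x (f : Fin k → Fin k → Bool) →
  ∑² k (λ i j → b2n (x ∧ f i j)) ≡ b2n x * ∑² k (λ i j → b2n (f i j))
∑²-∧ k x f = trans (∑-cong λ i → ∑-cong λ j → b2n-∧ x (f i j)) (∑²-*ˡ k (b2n x) λ i j → b2n (f i j))

∑³-∧ : ∀ k x (f : Fin k → Fin k → Fin k → Bool) →
  ∑³ k (λ i j l → b2n (x ∧ f i j l)) ≡ b2n x * ∑³ k (λ i j l → b2n (f i j l))
∑³-∧ k x f = trans (∑³-cong λ i j l → b2n-∧ x (f i j l)) (∑³-*ˡ k (b2n x) λ i j l → b2n (f i j l))

∑³-constˡ : ∀ k (f : Fin k → Fin k → ℕ) → ∑³ k (λ _ j l → f j l) ≡ k * ∑² k f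
∑³-constˡ k f = ∑-const k (∑² k f)

∑³-constʳ : ∀ k (f : Fin k → Fin k → ℕ) → ∑³ k (λ i j _ → f i j) ≡ k * ∑² k f
∑³-constʳ k f = trans (∑-cong λ i → ∑-cong λ j → ∑-const k (f i j)) (∑²-*ˡ k k f)

∑³-const : ∀ k c → ∑³ k (λ _ _ _ → c) ≡ k * (k * (k * c))
∑³-const k c =
  trans (∑³-constˡ k λ _ _ → c) (cong (k *_) (trans (∑-cong {k} λ _ → ∑-const k c) (∑-const k (k * c))))

∑³-δ₁₂₃ : ∀ k c → ∑³ k (λ u v w → b2n (does (u ≟ᶠ v) ∧ does (v ≟ᶠ w)) * c) ≡ k * c
∑³-δ₁₂₃ k c = trans (∑-cong λ u → begin
  ∑[ v < k ] ∑[ w < k ] (b2n (does (u ≟ᶠ v) ∧ does (v ≟ᶠ w)) * c)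
    ≡⟨ ∑-comm (λ v w → b2n (does (u ≟ᶠ v) ∧ does (v ≟ᶠ w)) * c) ⟩
  ∑[ w < k ] ∑[ v < k ] (b2n (does (u ≟ᶠ v) ∧ does (v ≟ᶠ w)) * c)
    ≡⟨ ∑-cong (λ w → ∑-δ-∧ˡ k u (λ v → does (v ≟ᶠ w)) λ _ → c) ⟩
  ∑[ w < k ] (b2n (does (u ≟ᶠ w)) * c)
    ≡⟨ ∑-δ k u (λ _ → c) ⟩
  c ∎) (∑-const k c)
  where open ≡-Reasoning

∑³-δ₁₂ : ∀ k (f : Fin k → Fin k → ℕ) →
  ∑³ k (λ u v w → b2n (does (u ≟ᶠ v) ∧ does (v <? w)) * f u w) ≡ ∑² k (λ u w → b2n (does (u <? w)) * f u w)
∑³-δ₁₂ k f = ∑-cong λ u → trans (∑-comm λ v w → b2n (does (u ≟ᶠ v) ∧ does (v <? w)) * f u w)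
                                 (∑-cong λ w → ∑-δ-∧ˡ k u (λ v → does (v <? w)) λ _ → f u w)

∑³-δ₂₃ : ∀ k (f : Fin k → Fin k → ℕ) →
  ∑³ k (λ u v w → b2n (does (u <? v) ∧ does (v ≟ᶠ w)) * f u v) ≡ ∑² k (λ u v → b2n (does (u <? v)) * f u v)
∑³-δ₂₃ k f = ∑-cong λ u → ∑-cong λ v → ∑-δ-∧ʳ k v (λ _ → does (u <? v)) λ _ → f u v

∑³-combine : ∀ k l (f : Fin (k * l) → Fin (k * l) → Fin (k * l) → ℕ) →
  ∑³ (k * l) f ≡ ∑³ k (λ u v w → ∑³ l λ a b c → f (combine u a) (combine v b) (combine w c))
∑³-combine k l f = begin
  ∑³ (k * l) f
    ≡⟨ trans (∑-combine k l λ x → ∑[ y < k * l ] ∑[ z < k * l ] f x y z) (∑-cong λ u → ∑-cong λ a →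
       trans (∑-combine k l λ y → ∑[ z < k * l ] f (combine {k} u a) y z) (∑-cong λ v → ∑-cong λ b →
       ∑-combine k l (f (combine {k} u a) (combine {k} v b)))) ⟩
  ∑[ u < k ] ∑[ a < l ] ∑[ v < k ] ∑[ b < l ] ∑[ w < k ] ∑[ c < l ] g u v w a b c
    ≡⟨ ∑-cong (λ u → trans (∑-comm λ a v → ∑[ b < l ] ∑[ w < k ] ∑[ c < l ] g u v w a b c)
         (∑-cong λ v → trans (∑-cong λ a → ∑-comm λ b w → ∑[ c < l ] g u v w a b c)
           (∑-comm λ a w → ∑[ b < l ] ∑[ c < l ] g u v w a b c))) ⟩
  ∑³ k (λ u v w → ∑³ l (g u v w)) ∎
  where
  open ≡-Reasoning
  g : Fin k → Fin k → Fin k → Fin l → Fin l → Fin l → ℕ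
  g u v w a b c = f (combine u a) (combine v b) (combine w c)

-- Definitionally the test (toℕ i <ᵇ toℕ j) ∧ (toℕ j <ᵇ toℕ l) with which `triples` lists subsets.
ordered : ∀ {k} → Fin k → Fin k → Fin k → Bool
ordered i j l = does (i <? j) ∧ does (j <? l)

tripleWith : (X : Graph) → ℕ → Fin (n X) → Fin (n X) → Fin (n X) → Bool
tripleWith X e i j k = ordered i j k ∧ does (edges3 X i j k ℕ.≟ e)

tripleCount : Graph → ℕ → ℕ
tripleCount X e = ∑³ (n X) λ i j k → b2n (tripleWith X e i j k)

module _ {A : Set} {P : Pred A 0ℓ} (P? : U.Decidable P) where

  length-filter-if : ∀ c x → length (filter P? (if c then x ∷ [] else [])) ≡ b2n (c ∧ does (P? x))
  length-filter-if false x = refl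
  length-filter-if true  x with does (P? x)
  ... | true  = refl
  ... | false = refl

  length-filter-concatMap : ∀ {B : Set} (g : B → List A) k (h : Fin k → B) →
    length (filter P? (concatMap g (tabulate h))) ≡ ∑[ i < k ] length (filter P? (g (h i)))
  length-filter-concatMap g zero    h = refl
  length-filter-concatMap g (suc k) h = begin
    length (filter P? (g (h zero) ++ rest))            ≡⟨ cong length (filter-++ P? (g (h zero)) rest) ⟩
    length (filter P? (g (h zero)) ++ filter P? rest)  ≡⟨ length-++ (filter P? (g (h zero))) ⟩
    length (filter P? (g (h zero))) + length (filter P? rest)
      ≡⟨ cong (length (filter P? (g (h zero))) +_) (length-filter-concatMap g k (h ∘ suc)) ⟩
    ∑[ i < suc k ] length (filter P? (g (h i)))        ∎
    where
    open ≡-Reasoning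
    rest : List A
    rest = concatMap g (tabulate (h ∘ suc))

hasEdges? : ∀ X e (t : Fin (n X) × Fin (n X) × Fin (n X)) →
  Dec (edges3 X (proj₁ t) (proj₁ (proj₂ t)) (proj₂ (proj₂ t)) ≡ e)
hasEdges? X e (i , j , k) = edges3 X i j k ℕ.≟ e

inducedCount≡tripleCount : ∀ X e → inducedCount X e ≡ tripleCount X e
inducedCount≡tripleCount X e =
  trans (length-filter-concatMap (hasEdges? X e) _ (n X) id) (∑-cong λ i →
  trans (length-filter-concatMap (hasEdges? X e) _ (n X) id) (∑-cong λ j →
  trans (length-filter-concatMap (hasEdges? X e) _ (n X) id) (∑-cong λ k →
  length-filter-if (hasEdges? X e) (ordered i j k) (i , j , k))))

Density : Graph → ℕ → ℕ → Set
Density X e c = 8 * inducedCount X e ≡ c * (n X C 3)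

Densities : Graph → Set
Densities X = Density X 3 1 × Density X 0 1 × Density X 2 3 × Density X 1 3

triples-small : ∀ k → k < 3 → triples k ≡ []
triples-small 0 _ = refl
triples-small 1 _ = refl
triples-small 2 _ = refl
triples-small (suc (suc (suc k))) (s≤s (s≤s (s≤s ())))

density-small : ∀ X e c → n X < 3 → Density X e c
density-small X e c n<3 = begin
  8 * inducedCount X e  ≡⟨ cong (λ ts → 8 * length (filter (hasEdges? X e) ts)) (triples-small (n X) n<3) ⟩
  0                     ≡⟨ *-zeroʳ c ⟨
  c * 0                 ≡⟨ cong (c *_) (k>n⇒nCk≡0 n<3) ⟨
  c * (n X C 3)         ∎
  where open ≡-Reasoning

threeSymmetric⇒densities : ∀ X → ThreeSymmetric X → Densities X
threeSymmetric⇒densities X (inj₁ n<3) =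
  density-small X 3 1 n<3 , density-small X 0 1 n<3 , density-small X 2 3 n<3 , density-small X 1 3 n<3
threeSymmetric⇒densities X (inj₂ (_ , densities)) = densities

combine-monoʳ-< : ∀ {k l} (u : Fin k) {a b : Fin l} → a <ᶠ b → combine u a <ᶠ combine u b
combine-monoʳ-< {l = l} u {a} {b} a<b =
  subst₂ _<_ (sym (toℕ-combine u a)) (sym (toℕ-combine u b)) (+-monoʳ-< (l * toℕ u) a<b)

combine-cancelʳ-< : ∀ {k l} (u : Fin k) {a b : Fin l} → combine u a <ᶠ combine u b → a <ᶠ b
combine-cancelʳ-< {l = l} u {a} {b} ua<ub =
  +-cancelˡ-< (l * toℕ u) _ _ (subst₂ _<_ (toℕ-combine u a) (toℕ-combine u b) ua<ub)

combine-<-lex : ∀ {k l} (u v : Fin k) (a b : Fin l) →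
  combine u a <ᶠ combine v b ⇔ (u <ᶠ v ⊎ (u ≡ v × a <ᶠ b))
combine-<-lex u v a b = mk⇔ to from
  where
  to : combine u a <ᶠ combine v b → u <ᶠ v ⊎ (u ≡ v × a <ᶠ b)
  to ua<vb with <-cmp u v
  ... | tri< u<v _ _    = inj₁ u<v
  ... | tri≈ _ refl _   = inj₂ (refl , combine-cancelʳ-< u ua<vb)
  ... | tri> _ _ v<u    = contradiction ua<vb (<-asym (combine-monoˡ-< b a v<u))
  from : u <ᶠ v ⊎ (u ≡ v × a <ᶠ b) → combine u a <ᶠ combine v b
  from (inj₁ u<v)         = combine-monoˡ-< a b u<v
  from (inj₂ (refl , a<b)) = combine-monoʳ-< u a<b

combine-<? : ∀ {k l} (u v : Fin k) (a b : Fin l) →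
  does (combine u a <? combine v b) ≡ does (u <? v) ∨ (does (u ≟ᶠ v) ∧ does (a <? b))
combine-<? u v a b =
  does-⇔ (combine-<-lex u v a b) (combine u a <? combine v b) ((u <? v) ⊎-dec ((u ≟ᶠ v) ×-dec (a <? b)))

eqb≡does-≟ : ∀ {k} (u v : Fin k) → eqb u v ≡ does (u ≟ᶠ v)
eqb≡does-≟ u v with u ≟ᶠ v
... | yes _ = refl
... | no _  = refl

adj-inflate : ∀ G H (u v : Fin (n G)) (a b : Fin (n H)) →
  adj (inflate G H) (combine u a) (combine v b) ≡ (does (u ≟ᶠ v) ∧ adj H a b) ∨ adj G u v
adj-inflate G H u v a b = begin
  pairAdj G H (remQuot (n H) (combine u a)) (remQuot (n H) (combine v b))
    ≡⟨ cong₂ (pairAdj G H) (remQuot-combine u a) (remQuot-combine v b) ⟩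
  (eqb u v ∧ adj H a b) ∨ adj G u v
    ≡⟨ cong (λ x → (x ∧ adj H a b) ∨ adj G u v) (eqb≡does-≟ u v) ⟩
  (does (u ≟ᶠ v) ∧ adj H a b) ∨ adj G u v ∎
  where open ≡-Reasoning

pairsWith : (X : Graph) → Bool → ℕ
pairsWith X β = ∑² (n X) λ u w → b2n (does (u <? w) ∧ does (adj X u w Bool.≟ β))

-- A pair a < b in one copy of H and a vertex of another copy, adjacent to both of them (β = true)
-- or to neither, span adj H a b + 2β edges.
crossWith : (H : Graph) → ℕ → Bool → Fin (n H) → Fin (n H) → Bool
crossWith H e β a b = does (a <? b) ∧ does (b2n (adj H a b) + b2n β + b2n β ℕ.≟ e)

crossPairs : Graph → ℕ → Bool → ℕ
crossPairs H e β = ∑² (n H) λ a b → b2n (crossWith H e β a b)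

crossCount : Graph → Graph → ℕ → ℕ
crossCount G H e = ∑² (n G) λ u w → b2n (does (u <? w)) * crossPairs H e (adj G u w)

module InflatedTriples (G H : Graph) (e : ℕ) where

  lexLess : Fin (n G) → Fin (n G) → Fin (n H) → Fin (n H) → Bool
  lexLess u v a b = does (u <? v) ∨ (does (u ≟ᶠ v) ∧ does (a <? b))

  inflatedAdj : Fin (n G) → Fin (n G) → Fin (n H) → Fin (n H) → Bool
  inflatedAdj u v a b = (does (u ≟ᶠ v) ∧ adj H a b) ∨ adj G u v

  indicator : Fin (n G) → Fin (n G) → Fin (n G) → Fin (n H) → Fin (n H) → Fin (n H) → ℕ
  indicator u v w a b c = b2n ((lexLess u v a b ∧ lexLess v w b c)
    ∧ does (b2n (inflatedAdj u v a b) + b2n (inflatedAdj u w a c) + b2n (inflatedAdj v w b c) ℕ.≟ e))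

  indicator-combine : ∀ u v w a b c →
    b2n (tripleWith (inflate G H) e (combine u a) (combine v b) (combine w c)) ≡ indicator u v w a b c
  indicator-combine u v w a b c = cong₂ (λ p q → b2n (p ∧ does (q ℕ.≟ e)))
    (cong₂ _∧_ (combine-<? u v a b) (combine-<? v w b c))
    (cong₂ _+_ (cong₂ _+_ (cong b2n (adj-inflate G H u v a b)) (cong b2n (adj-inflate G H u w a c)))
               (cong b2n (adj-inflate G H v w b c)))

  oneCopy twoThenOne oneThenTwo : Fin (n G) → Fin (n G) → Fin (n G) → Bool
  oneCopy    u v w = does (u ≟ᶠ v) ∧ does (v ≟ᶠ w)
  twoThenOne u v w = does (u ≟ᶠ v) ∧ does (v <? w)
  oneThenTwo u v w = does (u <? v) ∧ does (v ≟ᶠ w)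

  -- A lexicographically increasing triple (u , a) , (v , b) , (w , c) has u ≤ v ≤ w; the four
  -- summands are the cases u < v < w, u = v = w, u = v < w and u < v = w.
  indicator-split : ∀ u v w a b c → indicator u v w a b c ≡
      b2n (tripleWith G e u v w)
    + (b2n (oneCopy u v w ∧ tripleWith H e a b c)
    + (b2n (twoThenOne u v w ∧ crossWith H e (adj G u w) a b)
    +  b2n (oneThenTwo u v w ∧ crossWith H e (adj G u v) b c)))
  indicator-split u v w a b c with <-cmp u v | <-cmp v w
  ... | tri> _ u≢v v<u | _
    rewrite dec-false (u <? v) (<-asym v<u) | dec-false (u ≟ᶠ v) u≢v = refl
  ... | tri< u<v u≢v _ | tri< v<w v≢w _
    rewrite dec-true (u <? v) u<v | dec-false (u ≟ᶠ v) u≢v | dec-true (v <? w) v<w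
          | dec-false (v ≟ᶠ w) v≢w | dec-false (u ≟ᶠ w) (<⇒≢ (<-trans u<v v<w)) = sym (+-identityʳ _)
  ... | tri< u<v u≢v _ | tri> _ v≢w w<v
    rewrite dec-true (u <? v) u<v | dec-false (u ≟ᶠ v) u≢v | dec-false (v <? w) (<-asym w<v)
          | dec-false (v ≟ᶠ w) v≢w = refl
  ... | tri< u<v u≢v _ | tri≈ _ refl _
    rewrite dec-true (u <? v) u<v | dec-false (u ≟ᶠ v) u≢v | dec-false (v <? v) (<-irrefl refl)
          | dec-true (v ≟ᶠ v) refl | adj-irrefl G v | ∨-identityʳ (adj H b c) =
    cong (λ x → b2n (does (b <? c) ∧ does (x ℕ.≟ e))) (+-rotate (b2n (adj G u v)) (b2n (adj H b c)))
  ... | tri≈ _ refl _ | tri< u<w u≢w _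
    rewrite dec-false (u <? u) (<-irrefl refl) | dec-true (u ≟ᶠ u) refl | dec-true (u <? w) u<w
          | dec-false (u ≟ᶠ w) u≢w | adj-irrefl G u | ∨-identityʳ (adj H a b) | ∧-identityʳ (does (a <? b)) =
    sym (+-identityʳ _)
  ... | tri≈ _ refl _ | tri≈ _ refl _
    rewrite dec-false (u <? u) (<-irrefl refl) | dec-true (u ≟ᶠ u) refl | adj-irrefl G u
          | ∨-identityʳ (adj H a b) | ∨-identityʳ (adj H a c) | ∨-identityʳ (adj H b c) = sym (+-identityʳ _)
  ... | tri≈ _ refl _ | tri> _ u≢w w<u
    rewrite dec-false (u <? u) (<-irrefl refl) | dec-true (u ≟ᶠ u) refl | dec-false (u <? w) (<-asym w<u)
          | dec-false (u ≟ᶠ w) u≢w | ∧-zeroʳ (does (a <? b)) = refl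

  threeCopiesCount oneCopyCount twoThenOneCount oneThenTwoCount : Fin (n G) → Fin (n G) → Fin (n G) → ℕ
  threeCopiesCount u v w = n H * (n H * (n H * b2n (tripleWith G e u v w)))
  oneCopyCount     u v w = b2n (oneCopy u v w) * tripleCount H e
  twoThenOneCount  u v w = n H * (b2n (twoThenOne u v w) * crossPairs H e (adj G u w))
  oneThenTwoCount  u v w = n H * (b2n (oneThenTwo u v w) * crossPairs H e (adj G u v))

  ∑-indicator : ∀ u v w → ∑³ (n H) (indicator u v w) ≡
    threeCopiesCount u v w + (oneCopyCount u v w + (twoThenOneCount u v w + oneThenTwoCount u v w))
  ∑-indicator u v w = begin
    ∑³ M (indicator u v w)
      ≡⟨ ∑³-cong (indicator-split u v w) ⟩
    ∑³ M (λ a b c → t₁ a b c + (t₂ a b c + (t₃ a b c + t₄ a b c)))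
      ≡⟨ trans (∑³-+ M t₁ _) (cong (∑³ M t₁ +_) (trans (∑³-+ M t₂ _) (cong (∑³ M t₂ +_) (∑³-+ M t₃ t₄)))) ⟩
    ∑³ M t₁ + (∑³ M t₂ + (∑³ M t₃ + ∑³ M t₄))
      ≡⟨ cong₂ _+_ (∑³-const M _) (cong₂ _+_ (∑³-∧ M (oneCopy u v w) (tripleWith H e))
           (cong₂ _+_
             (trans (∑³-constʳ M _) (cong (M *_) (∑²-∧ M (twoThenOne u v w) (crossWith H e (adj G u w)))))
             (trans (∑³-constˡ M _) (cong (M *_) (∑²-∧ M (oneThenTwo u v w) (crossWith H e (adj G u v))))))) ⟩
    threeCopiesCount u v w + (oneCopyCount u v w + (twoThenOneCount u v w + oneThenTwoCount u v w)) ∎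
    where
    open ≡-Reasoning
    M : ℕ
    M = n H
    t₁ t₂ t₃ t₄ : Fin M → Fin M → Fin M → ℕ
    t₁ _ _ _ = b2n (tripleWith G e u v w)
    t₂ a b c = b2n (oneCopy u v w ∧ tripleWith H e a b c)
    t₃ a b _ = b2n (twoThenOne u v w ∧ crossWith H e (adj G u w) a b)
    t₄ _ b c = b2n (oneThenTwo u v w ∧ crossWith H e (adj G u v) b c)

  tripleCount-inflate : tripleCount (inflate G H) e ≡
      n H * (n H * (n H * tripleCount G e))
    + (n G * tripleCount H e + (n H * crossCount G H e + n H * crossCount G H e))
  tripleCount-inflate = begin
    tripleCount (inflate G H) e
      ≡⟨ ∑³-combine N M _ ⟩
    ∑³ N (λ u v w → ∑³ M λ a b c → b2n (tripleWith (inflate G H) e (combine u a) (combine v b) (combine w c)))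
      ≡⟨ ∑³-cong (λ u v w → trans (∑³-cong (indicator-combine u v w)) (∑-indicator u v w)) ⟩
    ∑³ N (λ u v w → threeCopiesCount u v w
                  + (oneCopyCount u v w + (twoThenOneCount u v w + oneThenTwoCount u v w)))
      ≡⟨ trans (∑³-+ N threeCopiesCount _) (cong (∑³ N threeCopiesCount +_) (trans (∑³-+ N oneCopyCount _)
           (cong (∑³ N oneCopyCount +_) (∑³-+ N twoThenOneCount oneThenTwoCount)))) ⟩
    ∑³ N threeCopiesCount + (∑³ N oneCopyCount + (∑³ N twoThenOneCount + ∑³ N oneThenTwoCount))
      ≡⟨ cong₂ _+_ threeCopies-sum
           (cong₂ _+_ (∑³-δ₁₂₃ N (tripleCount H e)) (cong₂ _+_ twoThenOne-sum oneThenTwo-sum)) ⟩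
    M * (M * (M * tripleCount G e)) + (N * tripleCount H e + (M * crossCount G H e + M * crossCount G H e)) ∎
    where
    open ≡-Reasoning
    N M : ℕ
    N = n G
    M = n H
    threeCopies-sum : ∑³ N threeCopiesCount ≡ M * (M * (M * tripleCount G e))
    threeCopies-sum = trans (∑³-*ˡ N M _) (cong (M *_) (trans (∑³-*ˡ N M _) (cong (M *_) (∑³-*ˡ N M _))))
    twoThenOne-sum : ∑³ N twoThenOneCount ≡ M * crossCount G H e
    twoThenOne-sum = trans (∑³-*ˡ N M _) (cong (M *_) (∑³-δ₁₂ N λ u w → crossPairs H e (adj G u w)))
    oneThenTwo-sum : ∑³ N oneThenTwoCount ≡ M * crossCount G H e
    oneThenTwo-sum = trans (∑³-*ˡ N M _) (cong (M *_) (∑³-δ₂₃ N λ u v → crossPairs H e (adj G u v)))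

edgeBits-≟ : ∀ α β α′ β′ →
  does (b2n α′ + b2n β′ + b2n β′ ℕ.≟ b2n α + b2n β + b2n β) ≡ does (β′ Bool.≟ β) ∧ does (α′ Bool.≟ α)
edgeBits-≟ false false false false = refl
edgeBits-≟ false false false true  = refl
edgeBits-≟ false false true  false = refl
edgeBits-≟ false false true  true  = refl
edgeBits-≟ false true  false false = refl
edgeBits-≟ false true  false true  = refl
edgeBits-≟ false true  true  false = refl
edgeBits-≟ false true  true  true  = refl
edgeBits-≟ true  false false false = refl
edgeBits-≟ true  false false true  = refl
edgeBits-≟ true  false true  false = refl
edgeBits-≟ true  false true  true  = refl
edgeBits-≟ true  true  false false = refl
edgeBits-≟ true  true  false true  = refl
edgeBits-≟ true  true  true  false = refl
edgeBits-≟ true  true  true  true  = refl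

crossPairs-bits : ∀ H α β β′ →
  crossPairs H (b2n α + b2n β + b2n β) β′ ≡ b2n (does (β′ Bool.≟ β)) * pairsWith H α
crossPairs-bits H α β β′ = trans
  (∑-cong λ a → ∑-cong λ b → cong b2n (begin
    does (a <? b) ∧ does (b2n (adj H a b) + b2n β′ + b2n β′ ℕ.≟ b2n α + b2n β + b2n β)
      ≡⟨ cong (does (a <? b) ∧_) (edgeBits-≟ α β (adj H a b) β′) ⟩
    does (a <? b) ∧ (does (β′ Bool.≟ β) ∧ does (adj H a b Bool.≟ α))
      ≡⟨ ∧-exchange (does (a <? b)) (does (β′ Bool.≟ β)) _ ⟩
    does (β′ Bool.≟ β) ∧ (does (a <? b) ∧ does (adj H a b Bool.≟ α)) ∎))
  (∑²-∧ (n H) (does (β′ Bool.≟ β)) λ a b → does (a <? b) ∧ does (adj H a b Bool.≟ α))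
  where open ≡-Reasoning

crossCount-bits : ∀ G H α β → crossCount G H (b2n α + b2n β + b2n β) ≡ pairsWith G β * pairsWith H α
crossCount-bits G H α β = begin
  ∑² (n G) (λ u w → b2n (does (u <? w)) * crossPairs H (b2n α + b2n β + b2n β) (adj G u w))
    ≡⟨ ∑-cong (λ u → ∑-cong λ w → begin
         b2n (does (u <? w)) * crossPairs H (b2n α + b2n β + b2n β) (adj G u w)
           ≡⟨ cong (b2n (does (u <? w)) *_) (crossPairs-bits H α β (adj G u w)) ⟩
         b2n (does (u <? w)) * (b2n (does (adj G u w Bool.≟ β)) * pairsWith H α)
           ≡⟨ *-assoc (b2n (does (u <? w))) _ (pairsWith H α) ⟨
         b2n (does (u <? w)) * b2n (does (adj G u w Bool.≟ β)) * pairsWith H α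
           ≡⟨ cong (_* pairsWith H α) (b2n-∧ (does (u <? w)) _) ⟨
         b2n (does (u <? w) ∧ does (adj G u w Bool.≟ β)) * pairsWith H α
           ≡⟨ *-comm _ (pairsWith H α) ⟩
         pairsWith H α * b2n (does (u <? w) ∧ does (adj G u w Bool.≟ β)) ∎) ⟩
  ∑² (n G) (λ u w → pairsWith H α * b2n (does (u <? w) ∧ does (adj G u w Bool.≟ β)))
    ≡⟨ ∑²-*ˡ (n G) (pairsWith H α) _ ⟩
  pairsWith H α * pairsWith G β
    ≡⟨ *-comm (pairsWith H α) (pairsWith G β) ⟩
  pairsWith G β * pairsWith H α ∎
  where open ≡-Reasoning

pairsWith-total : ∀ X → pairsWith X true + pairsWith X false ≡ ∑² (n X) (λ u w → b2n (does (u <? w)))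
pairsWith-total X =
  trans (sym (∑²-+ (n X) _ _)) (∑-cong λ u → ∑-cong λ w → split (does (u <? w)) (adj X u w))
  where
  split : ∀ l β → b2n (l ∧ does (β Bool.≟ true)) + b2n (l ∧ does (β Bool.≟ false)) ≡ b2n l
  split false β     = refl
  split true  true  = refl
  split true  false = refl

∑²-<-positive : ∀ k → 1 < k → 0 < ∑² k (λ u w → b2n (does (u <? w)))
∑²-<-positive (suc zero) (s≤s ())
∑²-<-positive (suc (suc k)) _ =
  ≤-trans (≤-∑ {suc (suc k)} (λ w → b2n (does (zero {suc k} <? w))) (suc zero))
          (≤-∑ {suc (suc k)} (λ u → ∑[ w < suc (suc k) ] b2n (does (u <? w))) zero)

pairsWith-positive : ∀ X → 1 < n X → 0 < pairsWith X true + pairsWith X false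
pairsWith-positive X 1<n = subst (0 <_) (sym (pairsWith-total X)) (∑²-<-positive (n X) 1<n)

+-*-cancelˡ-≡ : ∀ W K {x y} .{{_ : NonZero K}} → W + K * x ≡ W + K * y → x ≡ y
+-*-cancelˡ-≡ W K {x} {y} eq = *-cancelˡ-≡ x y K (+-cancelˡ-≡ W _ _ eq)

[3p]²≡p²⇒p≡0 : ∀ p → (3 * p) * (3 * p) ≡ p * p → p ≡ 0
[3p]²≡p²⇒p≡0 p eq = reduce (m*n≡0⇒m≡0∨n≡0 p (*-cancelˡ-≡ (p * p) 0 8 (+-cancelˡ-≡ (p * p) _ _ (begin
  p * p + 8 * (p * p)  ≡⟨ nine p ⟨
  3 * p * (3 * p)      ≡⟨ eq ⟩
  p * p                ≡⟨ +-identityʳ (p * p) ⟨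
  p * p + 0            ∎))))
  where
  open ≡-Reasoning
  nine : ∀ p → 3 * p * (3 * p) ≡ p * p + 8 * (p * p)
  nine = solve-∀

-- The two equations of weight 1 give g′h′ = gh, those of weight 3 give g′h = gh′ = 3gh, and
-- (gh′)(g′h) = (gh)(g′h′) then reads 9(gh)² = (gh)².
products-vanish : ∀ {K D Z g g′ h h′} → .{{NonZero K}} →
  1 * D ≡ 1 * Z + K * (g * h) → 1 * D ≡ 1 * Z + K * (g′ * h′) →
  3 * D ≡ 3 * Z + K * (g′ * h) → 3 * D ≡ 3 * Z + K * (g * h′) →
  (g + g′) * (h + h′) ≡ 0
products-vanish {K} {D} {Z} {g} {g′} {h} {h′} D₃ D₀ D₁ D₂ = begin
  (g + g′) * (h + h′)                  ≡⟨ expand g g′ h h′ ⟩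
  g * h + g * h′ + (g′ * h + g′ * h′)  ≡⟨ cong₂ _+_ (cong₂ _+_ gh≡0 (trans gh′≡3gh (cong (3 *_) gh≡0)))
                                                  (cong₂ _+_ (trans g′h≡3gh (cong (3 *_) gh≡0)) (trans g′h′≡gh gh≡0)) ⟩
  0                                    ∎
  where
  open ≡-Reasoning
  expand : ∀ g g′ h h′ → (g + g′) * (h + h′) ≡ g * h + g * h′ + (g′ * h + g′ * h′)
  expand = solve-∀
  triple : ∀ D Z p → 1 * D ≡ 1 * Z + K * p → 3 * D ≡ 3 * Z + K * (3 * p)
  triple D Z p eq = trans (scale D) (trans (cong (3 *_) eq) (distribute Z K p))
    where
    scale : ∀ D → 3 * D ≡ 3 * (1 * D)
    scale = solve-∀
    distribute : ∀ Z K p → 3 * (1 * Z + K * p) ≡ 3 * Z + K * (3 * p)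
    distribute = solve-∀
  exchange : ∀ g g′ h h′ → g * h′ * (g′ * h) ≡ g * h * (g′ * h′)
  exchange = solve-∀
  g′h′≡gh : g′ * h′ ≡ g * h
  g′h′≡gh = +-*-cancelˡ-≡ (1 * Z) K (trans (sym D₀) D₃)
  g′h≡3gh : g′ * h ≡ 3 * (g * h)
  g′h≡3gh = +-*-cancelˡ-≡ (3 * Z) K (trans (sym D₁) (triple D Z (g * h) D₃))
  gh′≡3gh : g * h′ ≡ 3 * (g * h)
  gh′≡3gh = +-*-cancelˡ-≡ (3 * Z) K (trans (sym D₂) (triple D Z (g * h) D₃))
  gh≡0 : g * h ≡ 0
  gh≡0 = [3p]²≡p²⇒p≡0 (g * h) (begin
    3 * (g * h) * (3 * (g * h))  ≡⟨ cong₂ _*_ gh′≡3gh g′h≡3gh ⟨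
    g * h′ * (g′ * h)            ≡⟨ exchange g g′ h h′ ⟩
    g * h * (g′ * h′)            ≡⟨ cong (g * h *_) g′h′≡gh ⟩
    g * h * (g * h)              ∎)

inflation-equation : ∀ G H α β c → let e = b2n α + b2n β + b2n β in
  Density G e c → Density H e c → Density (inflate G H) e c →
  c * (n G * n H C 3) ≡
    c * (n H * (n H * (n H * (n G C 3))) + n G * (n H C 3)) + 16 * n H * (pairsWith G β * pairsWith H α)
inflation-equation G H α β c dG dH dI = begin
  c * (N * M C 3)
    ≡⟨ dI ⟨
  8 * inducedCount (inflate G H) e
    ≡⟨ cong (8 *_) (trans (inducedCount≡tripleCount (inflate G H) e)
                          (InflatedTriples.tripleCount-inflate G H e)) ⟩
  8 * (M * (M * (M * tripleCount G e)) + (N * tripleCount H e + (M * crossCount G H e + M * crossCount G H e)))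
    ≡⟨ distribute M N (tripleCount G e) (tripleCount H e) (crossCount G H e) ⟩
  M * (M * (M * (8 * tripleCount G e))) + N * (8 * tripleCount H e) + 16 * M * crossCount G H e
    ≡⟨ cong₂ _+_ (cong₂ (λ x y → M * (M * (M * x)) + N * y)
                         (density-tripleCount G dG) (density-tripleCount H dH))
                 (cong (16 * M *_) (crossCount-bits G H α β)) ⟩
  M * (M * (M * (c * (N C 3)))) + N * (c * (M C 3)) + 16 * M * (pairsWith G β * pairsWith H α)
    ≡⟨ cong (_+ 16 * M * (pairsWith G β * pairsWith H α)) (collect M N c (N C 3) (M C 3)) ⟩
  c * (M * (M * (M * (N C 3))) + N * (M C 3)) + 16 * M * (pairsWith G β * pairsWith H α) ∎
  where
  open ≡-Reasoning
  N M e : ℕ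
  N = n G
  M = n H
  e = b2n α + b2n β + b2n β
  density-tripleCount : ∀ X → Density X e c → 8 * tripleCount X e ≡ c * (n X C 3)
  density-tripleCount X d = trans (cong (8 *_) (sym (inducedCount≡tripleCount X e))) d
  distribute : ∀ M N s t x →
    8 * (M * (M * (M * s)) + (N * t + (M * x + M * x))) ≡ M * (M * (M * (8 * s))) + N * (8 * t) + 16 * M * x
  distribute = solve-∀
  collect : ∀ M N c A B → M * (M * (M * (c * A))) + N * (c * B) ≡ c * (M * (M * (M * A)) + N * B)
  collect = solve-∀

mainTheorem12 : (G H : Graph) → ThreeSymmetric G → ThreeSymmetric H →
    1 < n G → 1 < n H → ¬ ThreeSymmetric (inflate G H)
mainTheorem12 G H _ _ 1<N 1<M (inj₁ NM<3) = <-asym NM<3 (*-mono-≤ 1<N 1<M)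
mainTheorem12 G H symG symH 1<N 1<M (inj₂ (_ , dI₃ , dI₀ , dI₂ , dI₁))
  with threeSymmetric⇒densities G symG | threeSymmetric⇒densities H symH
... | dG₃ , dG₀ , dG₂ , dG₁ | dH₃ , dH₀ , dH₂ , dH₁ =
  m<n⇒n≢0 (*-mono-≤ (pairsWith-positive G 1<N) (pairsWith-positive H 1<M))
    (products-vanish {g = pairsWith G true} {pairsWith G false} {pairsWith H true} {pairsWith H false}
      {{>-nonZero (*-mono-≤ {1} {16} (s≤s z≤n) (<⇒≤ 1<M))}}
      (inflation-equation G H true  true  1 dG₃ dH₃ dI₃)
      (inflation-equation G H false false 1 dG₀ dH₀ dI₀)
      (inflation-equation G H true  false 3 dG₁ dH₁ dI₁)
      (inflation-equation G H false true  3 dG₂ dH₂ dI₂))
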